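{- Let $K:=\exists\underline i\,\phi(\underline i,a[\underline i])$ be an $\exists^I$-formula and $(s,\mathcal M)$ a configuration. If $s$ belongs to a basis for $K$, then $(\mathcal M,\mathtt a)\models\phi(\underline i,a[\underline i])\to Min(\phi,a,\underline i)$ for every assignment $\mathtt a$ with $\mathtt a(a)=s$.
   Context: Fix $T_I=(\Sigma_I,\mathcal C_I)$ (sort INDEX) and $T_E=(\Sigma_E,\mathcal C_E)$ (sort ELEM). $A_I^E$ has sorts INDEX, ELEM, ARRAY, signature $\Sigma_I\cup\Sigma_E\cup\{\_[\_]\}$; its models are the three-sorted structures with INDEX-part $\mathcal M_I$ a model of $T_I$, ELEM-part $\mathcal M_E$ a model of $T_E$, ARRAY the set of all total functions INDEX$\to$ELEM, $a[i]$ function application. $\phi(\underline i,\underline e)$ denotes a quantifier-free $(\Sigma_I\cup\Sigma_E)$-formula and $\phi(\underline i,a[\underline i])$ the result of substituting $a[\underline i]$ for $\underline e$; an $\exists^I$-formula is $\exists\underline i\,\phi(\underline i,a[\underline i])$. Standing assumptions: $T_I$ is locally finite (signature finite and, for every finite tuple $\underline i$ of variables, there are finitely many effectively computable representative $\Sigma_I(\underline i)$-terms such that every $\Sigma_I(\underline i)$-term is $T_I$-provably equal to one of them) and closed under substructures; quantifier-free satisfiability modulo $T_I$ and $T_E$ is decidable. $Min(\phi,a,\underline i):=\phi(\underline i,a[\underline i])\wedge\bigwedge_\sigma\big(\phi(\underline i\sigma,a[\underline i\sigma])\to\bigwedge_{i\in\underline i}\bigvee_t(t\sigma=i)\big)$,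 where $t$ ranges over the representative $\Sigma_I(\underline i)$-terms and $\sigma$ over substitutions with domain $\underline i$ and values among the representative $\Sigma_I(\underline i)$-terms. A configuration is a pair $(s,\mathcal M)$, $\mathcal M$ a model of $A_I^E$ with finite INDEX domain, $s$ in its ARRAY domain; $s_I=\mathcal M_I$, $s_E$ the smallest $\Sigma_E$-substructure of $\mathcal M_E$ containing the image of $s$; $s'\le s$ iff there exist a $\Sigma_I$-embedding $\mu:s'_I\to s_I$ and a $\Sigma_E$-embedding $\nu:s'_E\to s_E$ with $\nu\circ s'=s\circ\mu$; $\uparrow s=\{t\mid s\le t\}$. $\widehat K$ is the set of configurations $(s,\mathcal M)$ with $\mathcal M\models K(s)$. A basis for $K$ is a minimal finite set $\{s_1,\dots,s_n\}$ of configurations with $\widehat K=\uparrow s_1\cup\dots\cup\uparrow s_n$. -}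

module Defs where

open import Level using (Level; _⊔_) renaming (suc to lsuc; zero to lzero)
open import Data.Nat using (ℕ; suc)
open import Data.Fin using (Fin)
open import Data.Vec as Vec using (Vec; []; _∷_)
open import Data.Vec.Relation.Unary.All using (All; []; _∷_)
open import Data.List using (List)
open import Data.List.Relation.Unary.Any using (Any)
open import Data.List.Membership.Propositional using (_∈_)
open import Data.Product using (Σ; Σ-syntax; ∃; ∃-syntax; _×_; _,_; proj₁; proj₂)
open import Data.Sum using (_⊎_; inj₁; inj₂)
open import Data.Unit using (⊤)
open import Data.Empty using (⊥)
open import Relation.Nullary using (¬_; Dec)
open import Relation.Binary.PropositionalEquality using (_≡_; refl; cong; cong₂)
open import Function.Bundles using (_↔_; _⇔_)
open import Function.Definitions using (Injective)
open import Data.Irrelevant as Irr using (Irrelevant; [_])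
open import Data.Refinement using (Refinement; _,_; value; proof)

Finite : Set → Set
Finite A = ∃[ n ] (A ↔ Fin n)

record Signature : Set₁ where
  field
    FSym   : Set
    farity : FSym → ℕ
    RSym   : Set
    rarity : RSym → ℕ
open Signature public

FiniteSignature : Signature → Set
FiniteSignature Σ' = Finite (FSym Σ') × Finite (RSym Σ')

data Term (Σ' : Signature) (X : Set) : Set where
  var : X → Term Σ' X
  app : (f : FSym Σ') → Vec (Term Σ' X) (farity Σ' f) → Term Σ' X

record Structure (Σ' : Signature) : Set₁ where
  field
    Carrier : Set
    fun     : (f : FSym Σ') → Vec Carrier (farity Σ' f) → Carrier
    rel     : (r : RSym Σ') → Vec Carrier (rarity Σ' r) → Set
open Structure public

module _ {Σ' : Signature} (M : Structure Σ') {X : Set} (ρ : X → Carrier M) where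
  mutual
    eval : Term Σ' X → Carrier M
    eval (var x)    = ρ x
    eval (app f ts) = fun M f (evalVec ts)

    evalVec : ∀ {k} → Vec (Term Σ' X) k → Vec (Carrier M) k
    evalVec []       = []
    evalVec (t ∷ ts) = eval t ∷ evalVec ts

-- A theory T = (Σ, C): a signature together with a class of Σ-structures.
Class : Signature → Set₁
Class Σ' = Structure Σ' → Set

record Embedding {Σ' : Signature} (A B : Structure Σ') : Set where
  field
    map     : Carrier A → Carrier B
    inj     : Injective _≡_ _≡_ map
    hom-fun : ∀ f (xs : Vec (Carrier A) (farity Σ' f)) →
              map (fun A f xs) ≡ fun B f (Vec.map map xs)
    hom-rel : ∀ r (xs : Vec (Carrier A) (rarity Σ' r)) →
              rel A r xs ⇔ rel B r (Vec.map map xs)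
open Embedding public

ClosedSubset : {Σ' : Signature} → (M : Structure Σ') → (Carrier M → Set) → Set
ClosedSubset {Σ'} M P = ∀ f (xs : Vec (Carrier M) (farity Σ' f)) → All P xs → P (fun M f xs)

private
  allIrr : {A : Set} {P : A → Set} {k : ℕ} (xs : Vec (Refinement A P) k) →
           Irrelevant (All P (Vec.map value xs))
  allIrr []       = [ [] ]
  allIrr (x ∷ xs) = Irr.zipWith _∷_ (proof x) (allIrr xs)

Substructure : {Σ' : Signature} (M : Structure Σ') (P : Carrier M → Set) →
               ClosedSubset M P → Structure Σ'
Substructure M P cl = record
  { Carrier = Refinement (Carrier M) P
  ; fun     = λ f xs → fun M f (Vec.map value xs) ,
                       Irr.map (cl f (Vec.map value xs)) (allIrr xs)
  ; rel     = λ r xs → rel M r (Vec.map value xs)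
  }

SubstructureClosed : {Σ' : Signature} → Class Σ' → Set₁
SubstructureClosed {Σ'} C =
  (M : Structure Σ') → C M → (P : Carrier M → Set) (cl : ClosedSubset M P) →
  C (Substructure M P cl)

-- The smallest substructure of M containing the image of g : X → Carrier M,
-- i.e. the set of values of Σ-terms over the image of g.
Generated : {Σ' : Signature} (M : Structure Σ') {X : Set} (g : X → Carrier M) →
            Carrier M → Set
Generated {Σ'} M {X} g e = ∃[ t ] (eval M g t ≡ e)

private
  genVec : {Σ' : Signature} (M : Structure Σ') {X : Set} (g : X → Carrier M) {k : ℕ}
           (es : Vec (Carrier M) k) → All (Generated M g) es →
           ∃[ ts ] (evalVec M g ts ≡ es)
  genVec M g []       []              = [] , refl
  genVec M g (e ∷ es) ((t , p) ∷ ps) with genVec M g es ps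
  ... | ts , q = t ∷ ts , cong₂ _∷_ p q

generated-closed : {Σ' : Signature} (M : Structure Σ') {X : Set} (g : X → Carrier M) →
                   ClosedSubset M (Generated M g)
generated-closed M g f es ps with genVec M g es ps
... | ts , q = app f ts , cong (fun M f) q

GenSub : {Σ' : Signature} (M : Structure Σ') {X : Set} (g : X → Carrier M) → Structure Σ'
GenSub M g = Substructure M (Generated M g) (generated-closed M g)

genIn : {Σ' : Signature} (M : Structure Σ') {X : Set} (g : X → Carrier M) →
        X → Carrier (GenSub M g)
genIn M g x = g x , [ var x , refl ]

data QF (A : Set) : Set where
  atom      : A → QF A
  tt ff     : QF A
  ¬'_       : QF A → QF A
  _∧'_ _∨'_ : QF A → QF A → QF A

⟦_⟧QF : {A : Set} → QF A → (A → Set) → Set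
⟦ atom a  ⟧QF I = I a
⟦ tt      ⟧QF I = ⊤
⟦ ff      ⟧QF I = ⊥
⟦ ¬' φ    ⟧QF I = ¬ ⟦ φ ⟧QF I
⟦ φ ∧' ψ  ⟧QF I = ⟦ φ ⟧QF I × ⟦ ψ ⟧QF I
⟦ φ ∨' ψ  ⟧QF I = ⟦ φ ⟧QF I ⊎ ⟦ ψ ⟧QF I

data Atom (Σ' : Signature) (X : Set) : Set where
  _≐_  : Term Σ' X → Term Σ' X → Atom Σ' X
  rel' : (r : RSym Σ') → Vec (Term Σ' X) (rarity Σ' r) → Atom Σ' X

⟦_⟧At : {Σ' : Signature} {X : Set} → Atom Σ' X → (M : Structure Σ') → (X → Carrier M) → Set
⟦ t ≐ u     ⟧At M ρ = eval M ρ t ≡ eval M ρ u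
⟦ rel' r ts ⟧At M ρ = rel M r (evalVec M ρ ts)

-- T-provable (= T-valid) equality of terms
_≈⟨_⟩_ : {Σ' : Signature} {X : Set} → Term Σ' X → Class Σ' → Term Σ' X → Set₁
_≈⟨_⟩_ {Σ'} {X} t C u = (M : Structure Σ') → C M → (ρ : X → Carrier M) → eval M ρ t ≡ eval M ρ u

record LocallyFinite (Σ' : Signature) (C : Class Σ') : Set₁ where
  field
    finiteSig : FiniteSignature Σ'
    reps      : (n : ℕ) → List (Term Σ' (Fin n))
    covers    : (n : ℕ) (t : Term Σ' (Fin n)) → ∃[ r ] (r ∈ reps n × t ≈⟨ C ⟩ r)
open LocallyFinite public

QFSatDecidable : (Σ' : Signature) → Class Σ' → Set₁
QFSatDecidable Σ' C = (n : ℕ) (ψ : QF (Atom Σ' (Fin n))) →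
  Dec (Σ[ M ∈ Structure Σ' ] (C M × Σ[ ρ ∈ (Fin n → Carrier M) ] ⟦ ψ ⟧QF (λ a → ⟦ a ⟧At M ρ)))

module Arrays (ΣI ΣE : Signature) (CI : Class ΣI) (CE : Class ΣE) where

  -- φ(i, e): quantifier-free (ΣI ∪ ΣE)-formula with index variables i₁…iₙ
  -- and element variables e₁…eₙ (the sorts are disjoint, so every atom is
  -- either a ΣI-atom over the i's or a ΣE-atom over the e's).
  Formula : ℕ → Set
  Formula n = QF (Atom ΣI (Fin n) ⊎ Atom ΣE (Fin n))

  ⟦_⟧ : {n : ℕ} → Formula n → (MI : Structure ΣI) (ME : Structure ΣE) →
        (Fin n → Carrier MI) → (Fin n → Carrier ME) → Set
  ⟦ φ ⟧ MI ME ρI ρE = ⟦ φ ⟧QF λ { (inj₁ a) → ⟦ a ⟧At MI ρI ; (inj₂ a) → ⟦ a ⟧At ME ρE }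

  -- (M, 𝚊) ⊨ φ(i τ, a[i τ]) where τ substitutes ΣI-terms for the index
  -- variables, a is interpreted by s and i by ρ.
  -- (φ(i,a[i]) is the case τ = var.)
  ⟦_[_]⟧ : {n : ℕ} → Formula n → (Fin n → Term ΣI (Fin n)) →
           (MI : Structure ΣI) (ME : Structure ΣE) →
           (s : Carrier MI → Carrier ME) → (Fin n → Carrier MI) → Set
  ⟦ φ [ τ ]⟧ MI ME s ρ = ⟦ φ ⟧ MI ME (λ k → eval MI ρ (τ k)) (λ k → s (eval MI ρ (τ k)))

  -- (M, 𝚊) ⊨ Min(φ, a, i), with a ↦ s and i ↦ ρ
  Min : {n : ℕ} → LocallyFinite ΣI CI → Formula n →
        (MI : Structure ΣI) (ME : Structure ΣE) →
        (s : Carrier MI → Carrier ME) → (Fin n → Carrier MI) → Set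
  Min {n} lf φ MI ME s ρ =
    ⟦ φ [ var ]⟧ MI ME s ρ ×
    ((σ : Fin n → Term ΣI (Fin n)) → (∀ k → σ k ∈ reps lf n) →
     ⟦ φ [ σ ]⟧ MI ME s ρ →
     (k : Fin n) → ∃[ t ] (t ∈ reps lf n ×
        eval MI (λ j → eval MI ρ (σ j)) t ≡ ρ k))

  record Config : Set₁ where
    field
      MI   : Structure ΣI
      MI∈  : CI MI
      finI : Finite (Carrier MI)
      ME   : Structure ΣE
      ME∈  : CE ME
      s    : Carrier MI → Carrier ME
  open Config public

  sE : (c : Config) → Structure ΣE
  sE c = GenSub (ME c) (s c)

  _≼_ : Config → Config → Set
  c' ≼ c = Σ[ μ ∈ Embedding (MI c') (MI c) ] Σ[ ν ∈ Embedding (sE c') (sE c) ]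
           (∀ i → map ν (genIn (ME c') (s c') i) ≡ genIn (ME c) (s c) (map μ i))

  K^ : {n : ℕ} → Formula n → Config → Set
  K^ {n} φ c = Σ[ ρ ∈ (Fin n → Carrier (MI c)) ] ⟦ φ [ var ]⟧ (MI c) (ME c) (s c) ρ

  Up : List Config → Config → Set₁
  Up cs c = Any (λ c' → c' ≼ c) cs

  Covers : {n : ℕ} → Formula n → List Config → Set₁
  Covers φ cs = (c : Config) → (K^ φ c → Up cs c) × (Up cs c → K^ φ c)

  _⊂_ : List Config → List Config → Set₁
  ds ⊂ cs = (∀ {d} → d ∈ ds → d ∈ cs) × ∃[ c ] (c ∈ cs × ¬ (c ∈ ds))

  IsBasis : {n : ℕ} → Formula n → List Config → Set₁
  IsBasis φ cs = Covers φ cs ×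
                 ((ds : List Config) → ds ⊂ cs → ¬ Covers φ ds)

-- Let c be a basis element and τ any index tuple with
-- φ(τ, s[τ]).  Restricting the index part of c to the substructure
-- generated by τ gives a configuration c' ≼ c that still satisfies K.
-- Minimality of the basis forces c ≼ c' (up to double negation), and an
-- embedding of the finite index set of c into its own subset c' must be
-- onto, so τ generates every index of c.  By local finiteness every
-- generated index is the value of a representative term; taking τ to be
-- the instance i σ of a substitution σ gives exactly the clause of Min.
-- Removing c from the basis needs equality of configurations, which is
-- not decidable, so the argument runs under double negation; this is
-- harmless because membership among finitely many representative values
-- is decidable.
module Submission where

open import Defs
open import Data.Nat using (ℕ; zero; suc; _+_)
open import Data.Nat.Properties using (1+n≰n)
open import Data.Fin using (Fin; zero; suc; punchOut)
open import Data.Fin.Properties using (_≟_; +↔⊎; injective⇒≤; punchOut-injective)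
open import Data.List using (List; []; _∷_)
open import Data.List.Membership.Propositional using (_∈_; _∉_; lose; find)
open import Data.List.Relation.Unary.Any using (Any; here; there; any?)
open import Data.List.Relation.Binary.Subset.Propositional using (_⊆_)
open import Data.List.Relation.Binary.Subset.Propositional.Properties using (Any-resp-⊆)
open import Data.Vec as Vec using (Vec; []; _∷_)
open import Data.Vec.Properties using (map-∘)
open import Data.Product using (∃-syntax; _×_; _,_; proj₁; proj₂)
open import Data.Product.Function.NonDependent.Propositional using (_×-⇔_)
open import Data.Sum using (_⊎_; inj₁; inj₂)
open import Data.Sum.Function.Propositional using (_⊎-⇔_; _⊎-↔_)
open import Data.Unit using (⊤; tt)
open import Data.Empty using (⊥; ⊥-elim; ⊥-elim-irr)
open import Relation.Nullary using (¬_; Dec; yes; no)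
open import Relation.Nullary.Decidable using (map′; via-injection; decidable-stable; ¬¬-excluded-middle)
open import Relation.Binary.Definitions using (DecidableEquality)
open import Relation.Binary.PropositionalEquality
open import Function using (_∘_)
open import Function.Bundles using (_↔_; _⇔_; Inverse; Injection; Equivalence; mk↔ₛ′; mk⇔)
open import Function.Definitions using (Injective)
open import Function.Properties.Inverse using (↔-sym; ↔-trans; ↔⇒↣)
open import Function.Construct.Identity using (⇔-id)
open import Function.Construct.Composition using (_⇔-∘_)
open import Function.Related.TypeIsomorphisms using (¬-cong-⇔)
open import Data.Irrelevant as Irr using ([_])
open import Data.Refinement using (Refinement; _,_; value; proof; value-injective)

↔-finite : {A B : Set} → A ↔ B → Finite B → Finite A
↔-finite e (m , f) = m , ↔-trans e f

⊎-finite : {A B : Set} → Finite A → Finite B → Finite (A ⊎ B)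
⊎-finite (m , e) (n , f) = m + n , ↔-trans (e ⊎-↔ f) (↔-sym +↔⊎)

finite-≟ : {A : Set} → Finite A → DecidableEquality A
finite-≟ (m , e) = via-injection (↔⇒↣ e) _≟_

proposition-finite : {Q : Set} → Dec Q → Finite (Refinement ⊤ (λ _ → Q))
proposition-finite (yes q) =
  1 , mk↔ₛ′ (λ _ → zero) (λ _ → tt , [ q ]) (λ { zero → refl }) (λ _ → refl)
proposition-finite (no ¬q) =
  0 , mk↔ₛ′ (⊥-elim ∘ impossible) (λ ()) (λ ()) (λ x → ⊥-elim (impossible x))
  where
  impossible : Refinement ⊤ _ → ⊥
  impossible (tt , [ q ]) = ⊥-elim-irr (¬q q)

refinement-split : {m : ℕ} {P : Fin (suc m) → Set} →
  Refinement (Fin (suc m)) P ↔ (Refinement ⊤ (λ _ → P zero) ⊎ Refinement (Fin m) (P ∘ suc))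
refinement-split {m} {P} = mk↔ₛ′ split join split-join join-split
  where
  split : Refinement (Fin (suc m)) P → Refinement ⊤ (λ _ → P zero) ⊎ Refinement (Fin m) (P ∘ suc)
  split (zero  , p) = inj₁ (tt , p)
  split (suc i , p) = inj₂ (i , p)
  join : Refinement ⊤ (λ _ → P zero) ⊎ Refinement (Fin m) (P ∘ suc) → Refinement (Fin (suc m)) P
  join (inj₁ (tt , p)) = zero , p
  join (inj₂ (i  , p)) = suc i , p
  split-join : ∀ x → split (join x) ≡ x
  split-join (inj₁ _) = refl
  split-join (inj₂ _) = refl
  join-split : ∀ x → join (split x) ≡ x
  join-split (zero  , _) = refl
  join-split (suc _ , _) = refl

fin-subset-finite : (m : ℕ) (P : Fin m → Set) → (∀ i → Dec (P i)) → Finite (Refinement (Fin m) P)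
fin-subset-finite zero    P P? = 0 , mk↔ₛ′ (λ { (() , _) }) (λ ()) (λ ()) (λ { (() , _) })
fin-subset-finite (suc m) P P? =
  ↔-finite refinement-split
    (⊎-finite (proposition-finite (P? zero)) (fin-subset-finite m (P ∘ suc) (P? ∘ suc)))

refinement-cong : {A B : Set} {P : A → Set} (e : A ↔ B) →
                  Refinement A P ↔ Refinement B (P ∘ Inverse.from e)
refinement-cong {P = P} e = mk↔ₛ′
  (λ { (a , p) → to a , Irr.map (subst P (sym (strictlyInverseʳ a))) p })
  (λ { (b , q) → from b , q })
  (λ { (b , _) → value-injective (strictlyInverseˡ b) })
  (λ { (a , _) → value-injective (strictlyInverseʳ a) })
  where open Inverse e

subset-finite : {A : Set} → Finite A → (P : A → Set) → (∀ a → Dec (P a)) →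
                Finite (Refinement A P)
subset-finite (m , e) P P? =
  ↔-finite (refinement-cong e) (fin-subset-finite m _ (P? ∘ Inverse.from e))

fin-injective-onto : {m : ℕ} (h : Fin m → Fin m) → Injective _≡_ _≡_ h →
                     (y : Fin m) → ¬ (∀ x → h x ≢ y)
fin-injective-onto {suc m} h h-inj y misses = 1+n≰n (injective⇒≤ squeeze-injective)
  where
  -- h avoids y, so it factors through Fin m by removing y
  squeeze : Fin (suc m) → Fin m
  squeeze x = punchOut (misses x ∘ sym)
  squeeze-injective : Injective _≡_ _≡_ squeeze
  squeeze-injective {x} {x′} eq =
    h-inj (punchOut-injective (misses x ∘ sym) (misses x′ ∘ sym) eq)

finite-injective-onto : {A : Set} → Finite A → (g : A → A) → Injective _≡_ _≡_ g →
                        (y : A) → ¬ (∀ x → g x ≢ y)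
finite-injective-onto (m , e) g g-inj y misses =
  fin-injective-onto (to ∘ g ∘ from) conj-injective (to y) conj-misses
  where
  open Inverse e
  to-injective : Injective _≡_ _≡_ to
  to-injective = Injection.injective (↔⇒↣ e)
  from-injective : Injective _≡_ _≡_ from
  from-injective {i} {j} eq = begin
    i             ≡⟨ strictlyInverseˡ i ⟨
    to (from i)   ≡⟨ cong to eq ⟩
    to (from j)   ≡⟨ strictlyInverseˡ j ⟩
    j             ∎
    where open ≡-Reasoning
  conj-injective : Injective _≡_ _≡_ (to ∘ g ∘ from)
  conj-injective eq = from-injective (g-inj (to-injective eq))
  conj-misses : ∀ i → to (g (from i)) ≢ to y
  conj-misses i eq = misses (from i) (to-injective eq)

rel-resp : {Σ' : Signature} (M : Structure Σ') (r : RSym Σ') {xs ys : Vec (Carrier M) (rarity Σ' r)} →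
           xs ≡ ys → rel M r xs ⇔ rel M r ys
rel-resp M r eq = mk⇔ (subst (rel M r) eq) (subst (rel M r) (sym eq))

module _ {Σ' : Signature} (M : Structure Σ') {P : Carrier M → Set} (cl : ClosedSubset M P)
         {X : Set} (ρ : X → Refinement (Carrier M) P) where
  mutual
    eval-substructure : (t : Term Σ' X) →
      value (eval (Substructure M P cl) ρ t) ≡ eval M (value ∘ ρ) t
    eval-substructure (var x)    = refl
    eval-substructure (app f ts) = cong (fun M f) (evalVec-substructure ts)

    evalVec-substructure : ∀ {k} (ts : Vec (Term Σ' X) k) →
      Vec.map value (evalVec (Substructure M P cl) ρ ts) ≡ evalVec M (value ∘ ρ) ts
    evalVec-substructure []       = refl
    evalVec-substructure (t ∷ ts) = cong₂ _∷_ (eval-substructure t) (evalVec-substructure ts)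

  atom-substructure : (a : Atom Σ' X) →
    ⟦ a ⟧At (Substructure M P cl) ρ ⇔ ⟦ a ⟧At M (value ∘ ρ)
  atom-substructure (t ≐ u) = mk⇔
    (λ eq → trans (sym (eval-substructure t)) (trans (cong value eq) (eval-substructure u)))
    (λ eq → value-injective (trans (eval-substructure t) (trans eq (sym (eval-substructure u)))))
  atom-substructure (rel' r ts) = rel-resp M r (evalVec-substructure ts)

module _ {Σ' : Signature} {X Y : Set} (h : X → Y) where
  mutual
    rename : Term Σ' X → Term Σ' Y
    rename (var x)    = var (h x)
    rename (app f ts) = app f (renameVec ts)

    renameVec : ∀ {k} → Vec (Term Σ' X) k → Vec (Term Σ' Y) k
    renameVec []       = []
    renameVec (t ∷ ts) = rename t ∷ renameVec ts

  mutual
    eval-rename : (M : Structure Σ') (g : Y → Carrier M) (t : Term Σ' X) →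
                  eval M g (rename t) ≡ eval M (g ∘ h) t
    eval-rename M g (var x)    = refl
    eval-rename M g (app f ts) = cong (fun M f) (evalVec-rename M g ts)

    evalVec-rename : (M : Structure Σ') (g : Y → Carrier M) {k : ℕ} (ts : Vec (Term Σ' X) k) →
                     evalVec M g (renameVec ts) ≡ evalVec M (g ∘ h) ts
    evalVec-rename M g []       = refl
    evalVec-rename M g (t ∷ ts) = cong₂ _∷_ (eval-rename M g t) (evalVec-rename M g ts)

generated-rename : {Σ' : Signature} (M : Structure Σ') {X Y : Set} (h : X → Y)
                   (g : Y → Carrier M) {e : Carrier M} →
                   Generated M (g ∘ h) e → Generated M g e
generated-rename M h g (t , eq) = rename h t , trans (eval-rename h M g t) eq

qf-cong : {A : Set} {I J : A → Set} → (∀ a → I a ⇔ J a) → (φ : QF A) → ⟦ φ ⟧QF I ⇔ ⟦ φ ⟧QF J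
qf-cong I⇔J (atom a) = I⇔J a
qf-cong I⇔J tt       = ⇔-id _
qf-cong I⇔J ff       = ⇔-id _
qf-cong I⇔J (¬' φ)   = ¬-cong-⇔ (qf-cong I⇔J φ)
qf-cong I⇔J (φ ∧' ψ) = qf-cong I⇔J φ ×-⇔ qf-cong I⇔J ψ
qf-cong I⇔J (φ ∨' ψ) = qf-cong I⇔J φ ⊎-⇔ qf-cong I⇔J ψ

_∘-embedding_ : {Σ' : Signature} {A B C : Structure Σ'} →
                Embedding B C → Embedding A B → Embedding A C
_∘-embedding_ {A = A} {B} {C} g f = record
  { map     = map g ∘ map f
  ; inj     = inj f ∘ inj g
  ; hom-fun = λ h xs → begin
      map g (map f (fun A h xs))                     ≡⟨ cong (map g) (hom-fun f h xs) ⟩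
      map g (fun B h (Vec.map (map f) xs))           ≡⟨ hom-fun g h (Vec.map (map f) xs) ⟩
      fun C h (Vec.map (map g) (Vec.map (map f) xs)) ≡⟨ cong (fun C h) (map-∘ (map g) (map f) xs) ⟨
      fun C h (Vec.map (map g ∘ map f) xs)           ∎
  ; hom-rel = λ r xs → rel-resp C r (sym (map-∘ (map g) (map f) xs))
                         ⇔-∘ (hom-rel g r (Vec.map (map f) xs) ⇔-∘ hom-rel f r xs)
  }
  where open ≡-Reasoning

inclusion : {Σ' : Signature} (M : Structure Σ') {P : Carrier M → Set} (cl : ClosedSubset M P) →
            Embedding (Substructure M P cl) M
inclusion M cl = record
  { map     = value
  ; inj     = value-injective
  ; hom-fun = λ _ _ → refl
  ; hom-rel = λ _ _ → ⇔-id _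
  }

substructure-inclusion : {Σ' : Signature} (M : Structure Σ') {P Q : Carrier M → Set}
  (clP : ClosedSubset M P) (clQ : ClosedSubset M Q) → (∀ {x} → P x → Q x) →
  Embedding (Substructure M P clP) (Substructure M Q clQ)
substructure-inclusion M clP clQ P⊆Q = record
  { map     = widen
  ; inj     = value-injective ∘ cong value
  ; hom-fun = λ f xs → value-injective (cong (fun M f) (map-∘ value widen xs))
  ; hom-rel = λ r xs → rel-resp M r (map-∘ value widen xs)
  }
  where
  widen : Refinement _ _ → Refinement _ _
  widen x = value x , Irr.map P⊆Q (proof x)

-- Up to double negation (equality need not be decidable), any element c
-- can be removed from a list: some sublist ds avoids c and, together
-- with c, still contains the whole list.
remove : {A : Set₁} (xs : List A) (c : A) →
         ¬ ¬ (∃[ ds ] (ds ⊆ xs × xs ⊆ c ∷ ds × c ∉ ds))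
remove []       c k = k ([] , (λ ()) , (λ ()) , (λ ()))
remove (x ∷ xs) c k = remove xs c λ (ds , ds⊆xs , xs⊆c∷ds , c∉ds) →
  ¬¬-excluded-middle {A = x ≡ c} λ
    { (yes refl) → k (ds , there ∘ ds⊆xs , (λ { (here refl) → here refl ; (there m) → xs⊆c∷ds m }) , c∉ds)
    ; (no x≢c)   → k (x ∷ ds ,
                      (λ { (here refl) → here refl ; (there m) → there (ds⊆xs m) }) ,
                      (λ { (here refl) → there (here refl) ; (there m) → keep-x (xs⊆c∷ds m) }) ,
                      (λ { (here c≡x) → x≢c (sym c≡x) ; (there m) → c∉ds m }))
    }
  where
  keep-x : ∀ {y ds} → y ∈ c ∷ ds → y ∈ c ∷ x ∷ ds
  keep-x (here eq) = here eq
  keep-x (there m) = there (there m)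

module _ {Σ' : Signature} {C : Class Σ'} (lf : LocallyFinite Σ' C) where

  RepGenerated : {n : ℕ} (M : Structure Σ') → (Fin n → Carrier M) → Carrier M → Set
  RepGenerated {n} M τ e = Any (λ t → eval M τ t ≡ e) (reps lf n)

  generated⇒rep : {n : ℕ} {M : Structure Σ'} → C M → (τ : Fin n → Carrier M)
                  {e : Carrier M} → Generated M τ e → RepGenerated M τ e
  generated⇒rep {n} {M} M∈C τ (t , t≡e) with covers lf n t
  ... | r , r∈reps , t≈r = lose r∈reps (trans (sym (t≈r M M∈C τ)) t≡e)

  rep-generated? : {n : ℕ} {M : Structure Σ'} → Finite (Carrier M) →
                   (τ : Fin n → Carrier M) (e : Carrier M) → Dec (RepGenerated M τ e)
  rep-generated? {M = M} fin τ e = any? (λ t → finite-≟ fin (eval M τ t) e) (reps lf _)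

  generated? : {n : ℕ} {M : Structure Σ'} → C M → Finite (Carrier M) →
               (τ : Fin n → Carrier M) (e : Carrier M) → Dec (Generated M τ e)
  generated? M∈C fin τ e = map′ from-rep (generated⇒rep M∈C τ) (rep-generated? fin τ e)
    where
    from-rep : RepGenerated _ τ e → Generated _ τ e
    from-rep g with t , _ , t≡e ← find g = t , t≡e

outside-subset : {A : Set} {P : A → Set} {y : A} → ¬ P y → (r : Refinement A P) → value r ≢ y
outside-subset ¬Py (_ , [ p ]) refl = ⊥-elim-irr (¬Py p)

module Configurations (ΣI ΣE : Signature) (CI : Class ΣI) (CE : Class ΣE) where
  open Arrays ΣI ΣE CI CE

  ≼-trans : {a b c : Config} → a ≼ b → b ≼ c → a ≼ c
  ≼-trans (μ₁ , ν₁ , comm₁) (μ₂ , ν₂ , comm₂) =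
    μ₂ ∘-embedding μ₁ , ν₂ ∘-embedding ν₁ , λ i → trans (cong (map ν₂) (comm₁ i)) (comm₂ (map μ₁ i))

  -- The restriction of a configuration c to the index substructure
  -- generated by a tuple τ (which is finite, generation being decidable).
  module Restriction (sc : SubstructureClosed CI) (c : Config) {n : ℕ}
                     (τ : Fin n → Carrier (MI c)) (τ-gen? : ∀ e → Dec (Generated (MI c) τ e)) where

    restrict : Config
    restrict = record
      { MI   = GenSub (MI c) τ
      ; MI∈  = sc (MI c) (MI∈ c) (Generated (MI c) τ) (generated-closed (MI c) τ)
      ; finI = subset-finite (finI c) (Generated (MI c) τ) τ-gen?
      ; ME   = ME c
      ; ME∈  = ME∈ c
      ; s    = s c ∘ value
      }

    restrict≼ : restrict ≼ c
    restrict≼ =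
      inclusion (MI c) (generated-closed (MI c) τ) ,
      substructure-inclusion (ME c) (generated-closed (ME c) (s restrict)) (generated-closed (ME c) (s c))
        (generated-rename (ME c) value (s c)) ,
      λ _ → refl

    -- φ(τ, s[τ]) in c gives a witness of K in the restriction, since the
    -- index atoms of φ are evaluated the same way in the substructure.
    restrict-K : (φ : Formula n) → ⟦ φ ⟧ (MI c) (ME c) τ (s c ∘ τ) → K^ φ restrict
    restrict-K φ φτ = genIn (MI c) τ , Equivalence.from (qf-cong
      (λ { (inj₁ a) → atom-substructure (MI c) (generated-closed (MI c) τ) (genIn (MI c) τ) a
         ; (inj₂ a) → ⇔-id _ })
      φ) φτ

    -- If c embeds back into its restriction, then the injective
    -- endomap of the finite index set through the restriction is onto,
    -- so every index is generated by τ.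
    restrict-exhausts : c ≼ restrict → (e : Carrier (MI c)) → ¬ ¬ Generated (MI c) τ e
    restrict-exhausts (μ , _) e ¬gen =
      finite-injective-onto (finI c) (value ∘ map μ) (inj μ ∘ value-injective) e
        (outside-subset ¬gen ∘ map μ)

  -- A basis element c is ≼-minimal among configurations satisfying K:
  -- if c' ≼ c satisfies K then (up to double negation) c ≼ c'.  Otherwise
  -- removing c from the basis would leave a proper subset still covering K̂.
  basis-minimal : {n : ℕ} (φ : Formula n) {B : List Config} → IsBasis φ B →
                  {c c' : Config} → c ∈ B → K^ φ c' → c' ≼ c → ¬ ¬ (c ≼ c')
  basis-minimal φ {B} (covers , minimal) {c} {c'} c∈B c'∈K c'≼c c⋠c' =
    remove B c λ (ds , ds⊆B , B⊆c∷ds , c∉ds) →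
      minimal ds (ds⊆B , c , c∈B , c∉ds) (λ d → still-covers ds ds⊆B B⊆c∷ds d , ⊆-sound ds⊆B d)
    where
    below-c' : ∃[ b ] (b ∈ B × b ≼ c')
    below-c' = find (proj₁ (covers c') c'∈K)

    ⊆-sound : {ds : List Config} → ds ⊆ B → (d : Config) → Up ds d → K^ φ d
    ⊆-sound ds⊆B d = proj₂ (covers d) ∘ Any-resp-⊆ ds⊆B

    still-covers : (ds : List Config) → ds ⊆ B → B ⊆ c ∷ ds → (d : Config) → K^ φ d → Up ds d
    still-covers ds ds⊆B B⊆c∷ds d d∈K with find (proj₁ (covers d) d∈K)
    ... | b' , b'∈B , b'≼d with B⊆c∷ds b'∈B
    ... | there b'∈ds = lose b'∈ds b'≼d
    ... | here refl with below-c'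
    ...   | b , b∈B , b≼c' with B⊆c∷ds b∈B
    ...     | here refl   = ⊥-elim (c⋠c' b≼c')
    ...     | there b∈ds  = lose b∈ds (≼-trans {b} {c'} {d} b≼c' (≼-trans {c'} {c} {d} c'≼c b'≼d))

  basis-rep-generated : (lf : LocallyFinite ΣI CI) → SubstructureClosed CI →
    {n : ℕ} (φ : Formula n) {B : List Config} → IsBasis φ B → {c : Config} → c ∈ B →
    (τ : Fin n → Carrier (MI c)) → ⟦ φ ⟧ (MI c) (ME c) τ (s c ∘ τ) →
    (e : Carrier (MI c)) → RepGenerated lf (MI c) τ e
  basis-rep-generated lf sc φ basis {c} c∈B τ φτ e =
    decidable-stable (rep-generated? lf {M = MI c} (finI c) τ e) λ ¬rep →
      basis-minimal φ basis {c' = restrict} c∈B (restrict-K φ φτ) restrict≼ λ c≼restrict →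
        restrict-exhausts c≼restrict e (¬rep ∘ generated⇒rep lf (MI∈ c) τ)
    where open Restriction sc c τ (generated? lf (MI∈ c) (finI c) τ)

corollary5p13 : (ΣI ΣE : Signature) (CI : Class ΣI) (CE : Class ΣE)
    (lf : LocallyFinite ΣI CI) → SubstructureClosed CI →
    QFSatDecidable ΣI CI → QFSatDecidable ΣE CE →
    let open Arrays ΣI ΣE CI CE in
    (n : ℕ) (φ : Formula n) (B : List Config) → IsBasis φ B →
    (c : Config) → c ∈ B →
    (ρ : Fin n → Carrier (MI c)) →
    ⟦ φ [ var ]⟧ (MI c) (ME c) (s c) ρ → Min lf φ (MI c) (ME c) (s c) ρ
corollary5p13 ΣI ΣE CI CE lf sc _ _ n φ B basis c c∈B ρ φρ = φρ , minimality
  where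
  open Arrays ΣI ΣE CI CE
  open Configurations ΣI ΣE CI CE
  minimality : (σ : Fin n → Term ΣI (Fin n)) → (∀ k → σ k ∈ reps lf n) →
               ⟦ φ [ σ ]⟧ (MI c) (ME c) (s c) ρ → (k : Fin n) →
               ∃[ t ] (t ∈ reps lf n × eval (MI c) (λ j → eval (MI c) ρ (σ j)) t ≡ ρ k)
  minimality σ _ φσ k =
    find (basis-rep-generated lf sc φ basis c∈B (λ j → eval (MI c) ρ (σ j)) φσ (ρ k))
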